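{- Let $\mathcal{A}$ be a central arrangement of $n$ hyperplanes in $\mathbb{C}^{\ell}$, let $\Bbbk$ be a field, let $E_1=\Bbbk^n$ with basis $e_1,\dots,e_n$, let $E=\bigwedge E_1$, let $I\subset E$ be the Orlik–Solomon ideal of $\mathcal{A}$, and let $I_2\subset \Lambda^2E_1$ be its degree-$2$ component, with associated projective linear subspace $[I_2]\subset\mathbb{P}(\Lambda^2E_1)$. Let $$\mathcal{W}_1=\{([a],[b])\in \mathbb{P}(E_1)\times\mathbb{P}(E_1)\mid a\wedge b\neq 0\},$$ let $\mu_1\colon\mathcal{W}_1\to\mathbb{P}(\Lambda^2E_1)$ be $([a],[b])\mapsto[a\wedge b]$, and let $\pi_1\colon\mathcal{W}_1\to\mathbb{P}(E_1)$ be the projection $([a],[b])\mapsto [a]$. Then $$R^1(\mathcal{A})=\pi_1\big(\mu_1^{ -1}([I_2])\big).$$ Equivalently, if $[I_2]^{\mathrm{dec}}:=G(2,E_1)\cap[I_2]\subset\mathbb{P}(\Lambda^2E_1)$ denotes the set of decomposable elements of $[I_2]$ (with $G(2,E_1)$ embedded via the Plücker embedding), and $p_1\colon\mathbb{F}(1,2;E_1)\to\mathbb{P}(E_1)$, $p_2\colon\mathbb{F}(1,2;E_1)\to G(2,E_1)$ are the projections from the flag variety of lines contained in planes in $E_1$, then $R^1(\mathcal{A})=p_1\big(p_2^{ -1}([I_2]^{\mathrm{dec}})\big)$.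
   Context: Let $\mathcal{A}=\{H_1,\dots,H_n\}$ be a central complex hyperplane arrangement in $\mathbb{C}^{\ell}$. The Orlik–Solomon ideal $I\subset E=\bigwedge(\Bbbk^n)$ (exterior algebra on degree-one generators $e_1,\dots,e_n$) is the ideal generated by all elements $\partial e_{i_1\dots i_r}:=\sum_q(-1)^{q-1}e_{i_1}\cdots\widehat{e_{i_q}}\cdots e_{i_r}$ for which $\operatorname{codim}(H_{i_1}\cap\cdots\cap H_{i_r})<r$; the Orlik–Solomon algebra is $A=E/I=H^*(\mathbb{C}^\ell\setminus\bigcup H_i,\Bbbk)$, with $A^1=E_1$. For $a\in A^1$, multiplication by $a$ gives a cochain complex $(A,a)\colon 0\to A^0\xrightarrow{a}A^1\xrightarrow{a}\cdots\xrightarrow{a}A^\ell\to 0$. The resonance varieties are $R^k(\mathcal{A})=\{a=\sum a_ie_i\in\mathbb{P}(A^1)\cong\mathbb{P}^{n-1}\mid H^k(A,a)\neq 0\}$ for $k\ge1$. -}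

module Defs where

open import Level using (Level; _⊔_) renaming (suc to lsuc)
open import Algebra.Bundles using (CommutativeRing)
open import Data.Nat using (ℕ)
open import Data.Fin using (Fin; _≟_)
open import Data.Product using (Σ; _×_; _,_; ∃)
open import Relation.Nullary using (¬_; yes; no)
open import Relation.Binary.PropositionalEquality using (_≢_)

record Field (c ℓ : Level) : Set (lsuc (c ⊔ ℓ)) where
  field
    commutativeRing : CommutativeRing c ℓ
  open CommutativeRing commutativeRing public
  field
    0≉1     : ¬ (0# ≈ 1#)
    inverse : ∀ x → ¬ (x ≈ 0#) → ∃ λ y → x * y ≈ 1#

-- Everything about the arrangement and its Orlik–Solomon algebra.
--   𝕜 : the coefficient field of the Orlik–Solomon algebra
--   F : the field over which the hyperplanes live (the paper's ℂ)
--   α : the arrangement, H_i = ker (α i) ⊂ F^ℓ, α i a linear form (central)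
module OS {c ℓ c′ ℓ′ : Level} (𝕜 : Field c ℓ) (F : Field c′ ℓ′)
          (n ℓdim : ℕ) (α : Fin n → Fin ℓdim → Field.Carrier F) where

  module K = Field 𝕜
  module Fd = Field F
  open K

  E₁ : Set c
  E₁ = Fin n → Carrier

  -- Λ²E₁, identified with alternating n×n arrays: the element a ∧ b
  -- has (p,q)-entry a_p b_q − a_q b_p  (so e_i ∧ e_j ↦ E_ij − E_ji).
  Λ² : Set c
  Λ² = Fin n → Fin n → Carrier

  _≈₁_ : E₁ → E₁ → Set ℓ
  a ≈₁ b = ∀ p → a p ≈ b p

  _≈₂_ : Λ² → Λ² → Set ℓ
  ω ≈₂ η = ∀ p q → ω p q ≈ η p q

  0₁ : E₁
  0₁ _ = 0#

  0₂ : Λ²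
  0₂ _ _ = 0#

  infixl 7 _∧_
  _∧_ : E₁ → E₁ → Λ²
  (a ∧ b) p q = a p * b q - a q * b p

  _+₂_ : Λ² → Λ² → Λ²
  (ω +₂ η) p q = ω p q + η p q

  _-₂_ : Λ² → Λ² → Λ²
  (ω -₂ η) p q = ω p q - η p q

  _•₂_ : Carrier → Λ² → Λ²
  (x •₂ ω) p q = x * ω p q

  e : Fin n → E₁
  e i p with i ≟ p
  ... | yes _ = 1#
  ... | no  _ = 0#

  ∂₂ : Fin n → Fin n → E₁
  ∂₂ i j p = e j p - e i p

  ∂₃ : Fin n → Fin n → Fin n → Λ²
  ∂₃ i j k = ((e j ∧ e k) -₂ (e i ∧ e k)) +₂ (e i ∧ e j)

  -- codim (H_i ∩ H_j) < 2, i.e. the forms α_i, α_j are linearly dependent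
  -- (codimension of an intersection of hyperplanes through 0 = rank of the
  -- defining forms).
  Dep₂ : Fin n → Fin n → Set (c′ ⊔ ℓ′)
  Dep₂ i j = Σ Fd.Carrier λ x → Σ Fd.Carrier λ y →
      ¬ (x Fd.≈ Fd.0# × y Fd.≈ Fd.0#)
    × (∀ t → (x Fd.* α i t) Fd.+ (y Fd.* α j t) Fd.≈ Fd.0#)

  -- codim (H_i ∩ H_j ∩ H_k) < 3
  Dep₃ : Fin n → Fin n → Fin n → Set (c′ ⊔ ℓ′)
  Dep₃ i j k = Σ Fd.Carrier λ x → Σ Fd.Carrier λ y → Σ Fd.Carrier λ z →
      ¬ (x Fd.≈ Fd.0# × y Fd.≈ Fd.0# × z Fd.≈ Fd.0#)
    × (∀ t → ((x Fd.* α i t) Fd.+ (y Fd.* α j t)) Fd.+ (z Fd.* α k t) Fd.≈ Fd.0#)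

  -- Generators of the degree-2 component I₂ of the Orlik–Solomon ideal:
  -- products x·∂e_{ij} (x ∈ E₁) for dependent pairs, and ∂e_{ijk} for
  -- dependent triples (generators ∂e_S with |S| ≥ 4 live in degree ≥ 3;
  -- ∂e_i = 1 never occurs since each α_i defines a hyperplane).
  data I₂-gen : Λ² → Set (c ⊔ c′ ⊔ ℓ′) where
    pair-gen   : ∀ i j (x : E₁) → i ≢ j → Dep₂ i j → I₂-gen (x ∧ ∂₂ i j)
    triple-gen : ∀ i j k → i ≢ j → i ≢ k → j ≢ k → Dep₃ i j k →
                 I₂-gen (∂₃ i j k)

  data I₂ : Λ² → Set (c ⊔ ℓ ⊔ c′ ⊔ ℓ′) where
    span-zero : ∀ {ω} → ω ≈₂ 0₂ → I₂ ω
    span-step : ∀ {ω ω′} (x : Carrier) (g : Λ²) → I₂-gen g → I₂ ω →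
                ω′ ≈₂ ((x •₂ g) +₂ ω) → I₂ ω′

  -- Cochain complex (A, a) in degrees 0 → 1 → 2 with A⁰ = 𝕜, A¹ = E₁,
  -- A² = Λ²E₁ / I₂:  d⁰(x) = x a,  d¹(b) = [a ∧ b].
  Cocycle¹ : E₁ → E₁ → Set (c ⊔ ℓ ⊔ c′ ⊔ ℓ′)
  Cocycle¹ a b = I₂ (a ∧ b)

  Coboundary¹ : E₁ → E₁ → Set (c ⊔ ℓ)
  Coboundary¹ a b = ∃ λ x → ∀ p → b p ≈ x * a p

  H¹≠0 : E₁ → Set (c ⊔ ℓ ⊔ c′ ⊔ ℓ′)
  H¹≠0 a = Σ E₁ λ b → Cocycle¹ a b × ¬ Coboundary¹ a b

  InR¹ : E₁ → Set (c ⊔ ℓ ⊔ c′ ⊔ ℓ′)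
  InR¹ a = H¹≠0 a

  InProjPreimage : E₁ → Set (c ⊔ ℓ ⊔ c′ ⊔ ℓ′)
  InProjPreimage a = Σ E₁ λ b → ¬ (b ≈₁ 0₁) × ¬ ((a ∧ b) ≈₂ 0₂) × I₂ (a ∧ b)

  IsHyperplaneArrangement : Set (c′ ⊔ ℓ′)
  IsHyperplaneArrangement =
      (∀ i → ¬ (∀ t → α i t Fd.≈ Fd.0#))
    × (∀ i j → i ≢ j → ¬ Dep₂ i j)

module Submission where

open import Defs
open import Level using (Level)
open import Data.Nat using (ℕ; zero; suc)
open import Data.Fin using (Fin; zero; suc)
open import Data.Product using (_×_; _,_)
open import Relation.Nullary using (¬_)
import Algebra.Properties.Group as GroupProperties
import Relation.Binary.Reasoning.Setoid as SetoidReasoning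

-- H¹(A, a) consists of the b with a ∧ b ∈ I₂, taken modulo 𝕜a. For a ≠ 0 one
-- has a ∧ b = 0 exactly when b ∈ 𝕜a: if a_p ≠ 0 then (a ∧ b)_{pq} = 0 says
-- b_q = (b_p / a_p) a_q. So a class [b] is nonzero iff a ∧ b ≠ 0, and together
-- with a ∧ b ∈ I₂ this is the condition ([a],[b]) ∈ μ₁⁻¹([I₂]). Nothing about
-- the arrangement beyond the shape of the complex A⁰ → A¹ → A² is used.

¬¬-∀-Fin : ∀ {p} n {P : Fin n → Set p} → (∀ i → ¬ ¬ P i) → ¬ ¬ (∀ i → P i)
¬¬-∀-Fin zero    ¬¬P ¬∀P = ¬∀P (λ ())
¬¬-∀-Fin (suc n) ¬¬P ¬∀P =
  ¬¬P zero λ P₀ → ¬¬-∀-Fin n (λ i → ¬¬P (suc i)) λ P₊ →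
    ¬∀P λ { zero → P₀ ; (suc i) → P₊ i }

module Resonance {c ℓ c′ ℓ′ : Level} (𝕜 : Field c ℓ) (F : Field c′ ℓ′)
    (n ℓdim : ℕ) (α : Fin n → Fin ℓdim → Field.Carrier F) where
  open OS 𝕜 F n ℓdim α
  open Field 𝕜
  open GroupProperties +-group using (x∙y⁻¹≈ε⇒x≈y)
  open SetoidReasoning setoid

  coboundary⇒∧≈0 : ∀ a b → Coboundary¹ a b → (a ∧ b) ≈₂ 0₂
  coboundary⇒∧≈0 a b (x , b≈xa) p q = begin
    a p * b q - a q * b p              ≈⟨ +-cong (*-congˡ (b≈xa q)) (-‿cong (*-congˡ (b≈xa p))) ⟩
    a p * (x * a q) - a q * (x * a p)  ≈⟨ +-congʳ (swap (a p) x (a q)) ⟩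
    a q * (x * a p) - a q * (x * a p)  ≈⟨ -‿inverseʳ _ ⟩
    0#                                 ∎
    where
    swap : ∀ u v w → u * (v * w) ≈ w * (v * u)
    swap u v w = begin
      u * (v * w)  ≈⟨ *-comm u (v * w) ⟩
      (v * w) * u  ≈⟨ *-congʳ (*-comm v w) ⟩
      (w * v) * u  ≈⟨ *-assoc w v u ⟩
      w * (v * u)  ∎

  ∧≈0⇒coboundary : ∀ a b p → ¬ (a p ≈ 0#) → (a ∧ b) ≈₂ 0₂ → Coboundary¹ a b
  ∧≈0⇒coboundary a b p aₚ≉0 a∧b≈0 with inverse (a p) aₚ≉0
  ... | y , aₚy≈1 = b p * y , b≈ka
    where
    b≈ka : ∀ q → b q ≈ (b p * y) * a q
    b≈ka q = begin
      b q                ≈⟨ sym (*-identityʳ (b q)) ⟩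
      b q * 1#           ≈⟨ *-congˡ (sym aₚy≈1) ⟩
      b q * (a p * y)    ≈⟨ sym (*-assoc (b q) (a p) y) ⟩
      (b q * a p) * y    ≈⟨ *-congʳ (*-comm (b q) (a p)) ⟩
      (a p * b q) * y    ≈⟨ *-congʳ (x∙y⁻¹≈ε⇒x≈y _ _ (a∧b≈0 p q)) ⟩
      (a q * b p) * y    ≈⟨ *-assoc (a q) (b p) y ⟩
      a q * (b p * y)    ≈⟨ *-comm (a q) (b p * y) ⟩
      (b p * y) * a q    ∎

  -- Equality in 𝕜 need not be decidable, so a nonzero coordinate of a is
  -- only available under double negation.
  ∧≈0⇒¬¬coboundary : ∀ a b → ¬ (a ≈₁ 0₁) → (a ∧ b) ≈₂ 0₂ → ¬ ¬ Coboundary¹ a b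
  ∧≈0⇒¬¬coboundary a b a≉0 a∧b≈0 ¬cob =
    ¬¬-∀-Fin n (λ p aₚ≉0 → ¬cob (∧≈0⇒coboundary a b p aₚ≉0 a∧b≈0)) a≉0

  zero-coboundary : ∀ a b → b ≈₁ 0₁ → Coboundary¹ a b
  zero-coboundary a b b≈0 = 0# , λ p → trans (b≈0 p) (sym (zeroˡ (a p)))

  R¹⇒projPreimage : ∀ a → ¬ (a ≈₁ 0₁) → InR¹ a → InProjPreimage a
  R¹⇒projPreimage a a≉0 (b , cocycle , ¬cob) =
      b
    , (λ b≈0 → ¬cob (zero-coboundary a b b≈0))
    , (λ a∧b≈0 → ∧≈0⇒¬¬coboundary a b a≉0 a∧b≈0 ¬cob)
    , cocycle

  projPreimage⇒R¹ : ∀ a → InProjPreimage a → InR¹ a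
  projPreimage⇒R¹ a (b , _ , a∧b≉0 , a∧b∈I₂) =
    b , a∧b∈I₂ , λ cob → a∧b≉0 (coboundary⇒∧≈0 a b cob)

proposition2p1 : ∀ {c ℓ c′ ℓ′ : Level} (𝕜 : Field c ℓ) (F : Field c′ ℓ′)
    (n ℓdim : ℕ) (α : Fin n → Fin ℓdim → Field.Carrier F) →
    OS.IsHyperplaneArrangement 𝕜 F n ℓdim α →
    (a : OS.E₁ 𝕜 F n ℓdim α) →
    ¬ (OS._≈₁_ 𝕜 F n ℓdim α a (OS.0₁ 𝕜 F n ℓdim α)) →
    (OS.InR¹ 𝕜 F n ℓdim α a → OS.InProjPreimage 𝕜 F n ℓdim α a)
    × (OS.InProjPreimage 𝕜 F n ℓdim α a → OS.InR¹ 𝕜 F n ℓdim α a)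
proposition2p1 𝕜 F n ℓdim α _ a a≉0 =
  R¹⇒projPreimage a a≉0 , projPreimage⇒R¹ a
  where open Resonance 𝕜 F n ℓdim α
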